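{- Let $a,b\ge0$, $n\ge1$ and $T\in\mathrm{SHST}(a,b,n)$. Then the depth sequence of the reading word $\mathrm{rw}(T)$ depends only on the first row of $T$; in particular, for each $1\le j\le a+b$, $\mathrm{depth}_j(\mathrm{rw}(T))$ equals the number of entries equal to $j+1$ in the first row of $T$.
   Context: $\mathrm{SHST}(a,b,n)$ is the set of semistandard Young tableaux of shape $(n(a+1),n^b)$ (first row $n(a+1)$ boxes, then $b$ rows of $n$ boxes) with each of $1,\dots,a+b+1$ occurring exactly $n$ times. The reading word $\mathrm{rw}(T)$ lists entries row by row, left to right, bottom row first. For a word $w$ and $j\ge1$, $\mathrm{depth}_j(w)$: take the subword of letters $j,j+1$, repeatedly delete adjacent pairs "$j+1$ immediately followed by $j$"; the result is $j^r(j+1)^s$ and $\mathrm{depth}_j(w)=s$. The depth sequence is $(\mathrm{depth}_1(w),\mathrm{depth}_2(w),\dots)$. -}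

module Defs where

open import Data.Nat using (ℕ; zero; suc; _+_; _*_; _≤_; _<_; _≟_)
open import Data.Nat.Properties using ()
open import Data.List using (List; []; _∷_; length; filter; reverse; concat; lookup)
open import Data.List.Relation.Unary.All using (All)
open import Data.Fin using (Fin; toℕ; fromℕ<)
open import Data.Product using (_×_; Σ; _,_)
open import Relation.Nullary using (yes; no; ¬_; _⊎-dec_)
open import Data.Unit using (⊤)
open import Relation.Binary.PropositionalEquality using (_≡_)
open import Data.Bool using (Bool; true; false; _∨_)
open import Relation.Nullary.Decidable using (⌊_⌋)

count : ℕ → List ℕ → ℕ
count x [] = 0
count x (y ∷ w) with x ≟ y
... | yes _ = suc (count x w)
... | no _ = count x w

-- a tableau is a list of rows (top row first); entries are natural numbers

WeaklyIncreasing : List ℕ → Set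
WeaklyIncreasing [] = ⊤
WeaklyIncreasing (x ∷ []) = ⊤
WeaklyIncreasing (x ∷ y ∷ w) = x ≤ y × WeaklyIncreasing (y ∷ w)

StrictlyBelow : List ℕ → List ℕ → Set
StrictlyBelow upper lower =
  Σ (length lower ≤ length upper) λ _ →
    (k : ℕ) (p : k < length lower) (q : k < length upper) →
      lookup upper (fromℕ< q) < lookup lower (fromℕ< p)

ColumnStrict : List (List ℕ) → Set
ColumnStrict [] = ⊤
ColumnStrict (r ∷ []) = ⊤
ColumnStrict (r ∷ s ∷ rs) = StrictlyBelow r s × ColumnStrict (s ∷ rs)

IsSSYT : List (List ℕ) → Set
IsSSYT T = All WeaklyIncreasing T × ColumnStrict T

record SHST (a b n : ℕ) (first : List ℕ) (rest : List (List ℕ)) : Set where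
  field
    ssyt       : IsSSYT (first ∷ rest)
    firstLen   : length first ≡ n * (a + 1)
    numRows    : length rest ≡ b
    restLen    : All (λ r → length r ≡ n) rest
    entryRange : All (All (λ x → 1 ≤ x × x ≤ a + b + 1)) (first ∷ rest)
    content    : (i : ℕ) → 1 ≤ i → i ≤ a + b + 1 →
                 count i (concat (first ∷ rest)) ≡ n

rw : List (List ℕ) → List ℕ
rw T = concat (reverse T)

subwordJ : ℕ → List ℕ → List ℕ
subwordJ j = filter (λ x → (x ≟ j) ⊎-dec (x ≟ suc j))

deleteOne : ℕ → List ℕ → List ℕ
deleteOne′ : ℕ → ℕ → List ℕ → List ℕ
deleteOne j [] = []
deleteOne j (x ∷ w) = deleteOne′ j x w
deleteOne′ j x [] = x ∷ []
deleteOne′ j x (y ∷ w) with x ≟ suc j | y ≟ j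
... | yes _ | yes _ = w
... | _     | _     = x ∷ deleteOne′ j y w

deleteIter : ℕ → ℕ → List ℕ → List ℕ
deleteIter j zero w = w
deleteIter j (suc k) w = deleteIter j k (deleteOne j w)

-- fully reduced subword: each deletion shortens the word by 2, so
-- (length w) iterations suffice to reach the form j^r (j+1)^s
reduced : ℕ → List ℕ → List ℕ
reduced j w = deleteIter j (length (subwordJ j w)) (subwordJ j w)

depth : ℕ → List ℕ → ℕ
depth j w = count (suc j) (reduced j w)

module Submission where

-- Read a word left to right, letting each j+1 open a
-- bracket and each j close one of the open brackets, if any; `unmatched j 0 w`
-- counts the brackets left open.  Deleting an adjacent pair "j+1 j" does not
-- change this count, and on a fully reduced word j^r (j+1)^s it equals s; hence
-- depth_j(w) = unmatched j 0 w (`depth≡unmatched`).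
--
-- The reading word of T = first ∷ rest is rw(rest) followed by the sorted row
-- `first`, and a sorted row R changes the count as u ↦ (u ∸ #j(R)) + #(j+1)(R).
-- So depth_j(rw T) = #(j+1)(first) once unmatched j 0 (rw rest) ≤ #j(first).
-- That bound comes from an invariant of column-strict tableaux (`Bounds`,
-- proved row by row from the bottom by `bounds`): the open brackets and the j's
-- of the rows read so far fit into the entries ≤ j+1 of the current top row.
-- For the second row, of length n, together with the fact that j occurs exactly
-- n times in T, this gives the bound; for j > a+b+1 the letter j+1 does not occur
-- in `rest` at all.

open import Defs
open import Data.Nat using (ℕ; zero; suc; _+_; _∸_; _≤_; _<_; _≟_; _≤?_; z≤n; s≤s; s≤s⁻¹)
open import Data.Nat.Properties
open import Data.Nat.Tactic.RingSolver using (solve-∀)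
open import Data.List using (List; []; _∷_; _++_; length; concat; reverse; filter)
open import Data.List.Properties
  using (unfold-reverse; concat-++; ++-identityʳ; filter-accept; filter-reject; length-filter)
open import Data.List.Relation.Unary.All as All using (All; []; _∷_)
open import Data.List.Relation.Unary.All.Properties using (concat⁺; all-filter)
open import Data.Product using (_×_; _,_; proj₁; proj₂)
open import Data.Sum using (_⊎_; inj₁; inj₂)
open import Data.Empty using (⊥-elim)
open import Data.Unit using (tt)
open import Function using (_∘_)
open import Relation.Nullary using (yes; no; ¬_; _⊎-dec_)
open import Relation.Binary.Definitions using (tri<; tri≈; tri>)
open import Relation.Unary using (Decidable)
open import Relation.Binary.PropositionalEquality
  using (_≡_; _≢_; refl; sym; trans; cong; module ≡-Reasoning)

count-here : ∀ x w → count x (x ∷ w) ≡ suc (count x w)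
count-here x w with x ≟ x
... | yes _ = refl
... | no x≢x = ⊥-elim (x≢x refl)

count-there : ∀ x y w → x ≢ y → count x (y ∷ w) ≡ count x w
count-there x y w x≢y with x ≟ y
... | yes x≡y = ⊥-elim (x≢y x≡y)
... | no _ = refl

count-++ : ∀ x u v → count x (u ++ v) ≡ count x u + count x v
count-++ x [] v = refl
count-++ x (y ∷ u) v with x ≟ y
... | yes _ = cong suc (count-++ x u v)
... | no _ = count-++ x u v

count-none : ∀ x w → All (_≢ x) w → count x w ≡ 0
count-none x [] [] = refl
count-none x (y ∷ w) (y≢x ∷ ps) = trans (count-there x y w (y≢x ∘ sym)) (count-none x w ps)

bracketStep : ℕ → ℕ → ℕ → ℕ
bracketStep j u x with x ≟ suc j
... | yes _ = suc u
... | no _ with x ≟ j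
...   | yes _ = u ∸ 1
...   | no _ = u

unmatched : ℕ → ℕ → List ℕ → ℕ
unmatched j u [] = u
unmatched j u (x ∷ w) = unmatched j (bracketStep j u x) w

bracketStep-open : ∀ j u → bracketStep j u (suc j) ≡ suc u
bracketStep-open j u with suc j ≟ suc j
... | yes _ = refl
... | no ne = ⊥-elim (ne refl)

bracketStep-close : ∀ j u → bracketStep j u j ≡ u ∸ 1
bracketStep-close j u with j ≟ suc j
... | yes e = ⊥-elim (1+n≢n (sym e))
... | no _ with j ≟ j
...   | yes _ = refl
...   | no ne = ⊥-elim (ne refl)

bracketStep-ignore : ∀ j u x → x ≢ suc j → x ≢ j → bracketStep j u x ≡ u
bracketStep-ignore j u x x≢1+j x≢j with x ≟ suc j
... | yes e = ⊥-elim (x≢1+j e)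
... | no _ with x ≟ j
...   | yes e = ⊥-elim (x≢j e)
...   | no _ = refl

data Role (j : ℕ) : ℕ → Set where
  opener  : Role j (suc j)
  closer  : Role j j
  ignored : ∀ {x} → x ≢ suc j → x ≢ j → Role j x

role : ∀ j x → Role j x
role j x with x ≟ suc j
... | yes refl = opener
... | no x≢1+j with x ≟ j
...   | yes refl = closer
...   | no x≢j = ignored x≢1+j x≢j

unmatched-++ : ∀ j u v w → unmatched j u (v ++ w) ≡ unmatched j (unmatched j u v) w
unmatched-++ j u [] w = refl
unmatched-++ j u (x ∷ v) w = unmatched-++ j (bracketStep j u x) v w

unmatched-noCloser : ∀ j u v → count j v ≡ 0 → unmatched j u v ≡ u + count (suc j) v
unmatched-noCloser j u [] _ = sym (+-identityʳ u)
unmatched-noCloser j u (x ∷ v) noJ with role j x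
... | opener
  rewrite bracketStep-open j u | count-here (suc j) v | count-there j (suc j) v (1+n≢n ∘ sym) =
  trans (unmatched-noCloser j (suc u) v noJ) (sym (+-suc u (count (suc j) v)))
... | closer = ⊥-elim (0≢1+n (trans (sym noJ) (count-here j v)))
... | ignored x≢1+j x≢j
  rewrite bracketStep-ignore j u x x≢1+j x≢j | count-there (suc j) x v (x≢1+j ∘ sym)
        | count-there j x v (x≢j ∘ sym) = unmatched-noCloser j u v noJ

unmatched-≤ : ∀ j u v → unmatched j u v ≤ u + count (suc j) v
unmatched-≤ j u [] = ≤-reflexive (sym (+-identityʳ u))
unmatched-≤ j u (x ∷ v) with role j x
... | opener rewrite bracketStep-open j u | count-here (suc j) v =
  ≤-trans (unmatched-≤ j (suc u) v) (≤-reflexive (sym (+-suc u (count (suc j) v))))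
... | closer rewrite bracketStep-close j u | count-there (suc j) j v 1+n≢n =
  ≤-trans (unmatched-≤ j (u ∸ 1) v) (+-monoˡ-≤ _ (m∸n≤m u 1))
... | ignored x≢1+j x≢j
  rewrite bracketStep-ignore j u x x≢1+j x≢j | count-there (suc j) x v (x≢1+j ∘ sym) =
  unmatched-≤ j u v

IsLetter : ℕ → ℕ → Set
IsLetter j x = x ≡ j ⊎ x ≡ suc j

isLetter? : ∀ j → Decidable (IsLetter j)
isLetter? j x = (x ≟ j) ⊎-dec (x ≟ suc j)

subword-letters : ∀ j w → All (IsLetter j) (subwordJ j w)
subword-letters j = all-filter (isLetter? j)

-- the ignored letters are exactly those the subword drops
unmatched-subword : ∀ j u w → unmatched j u (subwordJ j w) ≡ unmatched j u w
unmatched-subword j u [] = refl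
unmatched-subword j u (x ∷ w) with role j x
... | opener rewrite filter-accept (isLetter? j) {x = suc j} {xs = w} (inj₂ refl) =
  unmatched-subword j (bracketStep j u (suc j)) w
... | closer rewrite filter-accept (isLetter? j) {x = j} {xs = w} (inj₁ refl) =
  unmatched-subword j (bracketStep j u j) w
... | ignored x≢1+j x≢j
  rewrite filter-reject (isLetter? j) {x = x} {xs = w} (λ { (inj₁ e) → x≢j e ; (inj₂ e) → x≢1+j e })
        | bracketStep-ignore j u x x≢1+j x≢j = unmatched-subword j u w

data DeleteStep (j x y : ℕ) (w : List ℕ) : List ℕ → Set where
  cancels : x ≡ suc j → y ≡ j → DeleteStep j x y w w
  keeps   : ¬ (x ≡ suc j × y ≡ j) → DeleteStep j x y w (x ∷ deleteOne j (y ∷ w))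

deleteStep : ∀ j x y w → DeleteStep j x y w (deleteOne j (x ∷ y ∷ w))
deleteStep j x y w with x ≟ suc j | y ≟ j
... | yes x≡1+j | yes y≡j = cancels x≡1+j y≡j
... | no x≢1+j | _ = keeps (x≢1+j ∘ proj₁)
... | yes _ | no y≢j = keeps (y≢j ∘ proj₂)

-- a cancelled pair opens and immediately closes a bracket
unmatched-deleteOne : ∀ j u v → unmatched j u (deleteOne j v) ≡ unmatched j u v
unmatched-deleteOne j u [] = refl
unmatched-deleteOne j u (x ∷ v) = front u x v
  where
  front : ∀ u x v → unmatched j u (deleteOne j (x ∷ v)) ≡ unmatched j u (x ∷ v)
  front u x [] = refl
  front u x (y ∷ w) with deleteOne j (x ∷ y ∷ w) | deleteStep j x y w
  ... | _ | cancels refl refl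
    rewrite bracketStep-open j u | bracketStep-close j (suc u) = refl
  ... | _ | keeps _ = front (bracketStep j u x) y w

deleteOne-letters : ∀ j v → All (IsLetter j) v → All (IsLetter j) (deleteOne j v)
deleteOne-letters j [] [] = []
deleteOne-letters j (x ∷ v) (px ∷ pv) = front x v px pv
  where
  front : ∀ x v → IsLetter j x → All (IsLetter j) v → All (IsLetter j) (deleteOne j (x ∷ v))
  front x [] px [] = px ∷ []
  front x (y ∷ w) px (py ∷ pw) with deleteOne j (x ∷ y ∷ w) | deleteStep j x y w
  ... | _ | cancels _ _ = pw
  ... | _ | keeps _ = px ∷ front y w py pw

data Settled (j : ℕ) : List ℕ → Set where
  openers : ∀ {w} → All (_≡ suc j) w → Settled j w
  closer∷ : ∀ {w} → Settled j w → Settled j (j ∷ w)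

-- on a settled word the j's find nothing to close and every j+1 stays open
unmatched-settled : ∀ j w → Settled j w → unmatched j 0 w ≡ count (suc j) w
unmatched-settled j w (openers ps) =
  unmatched-noCloser j 0 w (count-none j w (All.map (λ x≡1+j x≡j → 1+n≢n (trans (sym x≡1+j) x≡j)) ps))
unmatched-settled j (j ∷ w) (closer∷ s)
  rewrite bracketStep-close j 0 | count-there (suc j) j w 1+n≢n = unmatched-settled j w s

settled-cons : ∀ j x y w → IsLetter j x → ¬ (x ≡ suc j × y ≡ j) →
  Settled j (y ∷ w) → Settled j (x ∷ y ∷ w)
settled-cons j x y w (inj₁ refl) _ s = closer∷ s
settled-cons j x y w (inj₂ refl) _ (openers ps) = openers (refl ∷ ps)
settled-cons j x y w (inj₂ refl) noPair (closer∷ _) = ⊥-elim (noPair (refl , refl))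

deleteOne-progress : ∀ j v → All (IsLetter j) v →
  suc (suc (length (deleteOne j v))) ≡ length v ⊎ (deleteOne j v ≡ v × Settled j v)
deleteOne-progress j [] [] = inj₂ (refl , openers [])
deleteOne-progress j (x ∷ v) (px ∷ pv) = front x v px pv
  where
  front : ∀ x v → IsLetter j x → All (IsLetter j) v →
    suc (suc (length (deleteOne j (x ∷ v)))) ≡ suc (length v) ⊎
    (deleteOne j (x ∷ v) ≡ x ∷ v × Settled j (x ∷ v))
  front x [] (inj₁ refl) [] = inj₂ (refl , closer∷ (openers []))
  front x [] (inj₂ refl) [] = inj₂ (refl , openers (refl ∷ []))
  front x (y ∷ w) px (py ∷ pw) with deleteOne j (x ∷ y ∷ w) | deleteStep j x y w
  ... | _ | cancels _ _ = inj₁ refl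
  ... | _ | keeps noPair with front y w py pw
  ...   | inj₁ shorter = inj₁ (cong suc shorter)
  ...   | inj₂ (fixed , s) = inj₂ (cong (x ∷_) fixed , settled-cons j x y w px noPair s)

deleteIter-fixed : ∀ j k v → deleteOne j v ≡ v → deleteIter j k v ≡ v
deleteIter-fixed j zero v _ = refl
deleteIter-fixed j (suc k) v fixed rewrite fixed = deleteIter-fixed j k v fixed

count-deleteIter : ∀ j k v → All (IsLetter j) v → length v ≤ k →
  count (suc j) (deleteIter j k v) ≡ unmatched j 0 v
count-deleteIter j zero [] _ _ = refl
count-deleteIter j (suc k) v ps len≤ with deleteOne-progress j v ps
... | inj₁ shorter =
  trans (count-deleteIter j k (deleteOne j v) (deleteOne-letters j v ps) len′≤)
        (unmatched-deleteOne j 0 v)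
  where
  len′≤ : length (deleteOne j v) ≤ k
  len′≤ = ≤-trans (n≤1+n _) (s≤s⁻¹ (≤-trans (≤-reflexive shorter) len≤))
... | inj₂ (fixed , s) rewrite fixed | deleteIter-fixed j k v fixed = sym (unmatched-settled j v s)

-- depth_j is the bracket count: `reduced` deletes as often as the subword is long
depth≡unmatched : ∀ j w → depth j w ≡ unmatched j 0 w
depth≡unmatched j w =
  trans (count-deleteIter j (length (subwordJ j w)) (subwordJ j w) (subword-letters j w) ≤-refl)
        (unmatched-subword j 0 w)

wi-tail : ∀ x w → WeaklyIncreasing (x ∷ w) → WeaklyIncreasing w
wi-tail x [] _ = tt
wi-tail x (y ∷ w) (_ , wi) = wi

wi-head≤ : ∀ x w → WeaklyIncreasing (x ∷ w) → All (x ≤_) w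
wi-head≤ x [] _ = []
wi-head≤ x (y ∷ w) (x≤y , wi) = x≤y ∷ All.map (≤-trans x≤y) (wi-head≤ y w wi)

noCloserAfter : ∀ j R → WeaklyIncreasing (suc j ∷ R) → count j R ≡ 0
noCloserAfter j R wi =
  count-none j R (All.map (λ j<y y≡j → <-irrefl (sym y≡j) j<y) (wi-head≤ (suc j) R wi))

-- a sorted row reads as j^r (j+1)^s up to ignored letters: its j's close what
-- they can of the u open brackets, then its j+1's open new ones
unmatched-sortedRow : ∀ j u R → WeaklyIncreasing R →
  unmatched j u R ≡ (u ∸ count j R) + count (suc j) R
unmatched-sortedRow j u [] _ = sym (+-identityʳ u)
unmatched-sortedRow j u (x ∷ R) wi with role j x
... | opener rewrite bracketStep-open j u | count-here (suc j) R
                   | count-there j (suc j) R (1+n≢n ∘ sym) | noCloserAfter j R wi =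
  trans (unmatched-noCloser j (suc u) R (noCloserAfter j R wi)) (sym (+-suc u (count (suc j) R)))
... | closer rewrite bracketStep-close j u | count-here j R
                   | count-there (suc j) j R 1+n≢n =
  trans (unmatched-sortedRow j (u ∸ 1) R (wi-tail j R wi))
        (cong (_+ count (suc j) R) (∸-+-assoc u 1 (count j R)))
... | ignored x≢1+j x≢j
  rewrite bracketStep-ignore j u x x≢1+j x≢j | count-there (suc j) x R (x≢1+j ∘ sym)
        | count-there j x R (x≢j ∘ sym) = unmatched-sortedRow j u R (wi-tail x R wi)

atMost : ℕ → List ℕ → ℕ
atMost y R = length (filter (_≤? y) R)

atMost-accept : ∀ y x R → x ≤ y → atMost y (x ∷ R) ≡ suc (atMost y R)
atMost-accept y x R x≤y = cong length (filter-accept (_≤? y) x≤y)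

atMost-reject : ∀ y x R → ¬ x ≤ y → atMost y (x ∷ R) ≡ atMost y R
atMost-reject y x R x≰y = cong length (filter-reject (_≤? y) x≰y)

atMost-suc : ∀ y R → atMost (suc y) R ≡ atMost y R + count (suc y) R
atMost-suc y [] = refl
atMost-suc y (x ∷ R) with <-cmp x (suc y)
... | tri< x<1+y _ _
  rewrite atMost-accept (suc y) x R (<⇒≤ x<1+y) | atMost-accept y x R (s≤s⁻¹ x<1+y)
        | count-there (suc y) x R (λ e → <-irrefl (sym e) x<1+y) = cong suc (atMost-suc y R)
... | tri≈ _ refl _
  rewrite atMost-accept (suc y) (suc y) R ≤-refl | atMost-reject y (suc y) R (<-irrefl refl)
        | count-here (suc y) R = trans (cong suc (atMost-suc y R)) (sym (+-suc (atMost y R) _))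
... | tri> _ _ 1+y<x
  rewrite atMost-reject (suc y) x R (<⇒≱ 1+y<x)
        | atMost-reject y x R (λ x≤y → <⇒≱ 1+y<x (≤-trans x≤y (n≤1+n y)))
        | count-there (suc y) x R (λ e → <-irrefl e 1+y<x) = atMost-suc y R

atMost-none : ∀ y R → All (y <_) R → atMost y R ≡ 0
atMost-none y [] [] = refl
atMost-none y (x ∷ R) (y<x ∷ ps) rewrite atMost-reject y x R (<⇒≱ y<x) = atMost-none y R ps

data Below : List ℕ → List ℕ → Set where
  []  : ∀ {P} → Below P []
  _∷_ : ∀ {p P r R} → p < r → Below P R → Below (p ∷ P) (r ∷ R)

strictlyBelow⇒Below : ∀ P R → StrictlyBelow P R → Below P R
strictlyBelow⇒Below P [] _ = []
strictlyBelow⇒Below [] (r ∷ R) (() , _)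
strictlyBelow⇒Below (p ∷ P) (r ∷ R) (s≤s len≤ , col<) =
  col< 0 (s≤s z≤n) (s≤s z≤n) ∷ strictlyBelow⇒Below P R (len≤ , λ k p q → col< (suc k) (s≤s p) (s≤s q))

-- an entry ≤ y+1 of the lower row sits under an entry ≤ y of the upper row
atMost-below : ∀ y P R → Below P R → WeaklyIncreasing R → atMost (suc y) R ≤ atMost y P
atMost-below y P [] [] _ = z≤n
atMost-below y (p ∷ P) (r ∷ R) (p<r ∷ below) wi with r ≤? suc y
... | yes r≤1+y rewrite atMost-accept (suc y) r R r≤1+y | atMost-accept y p P (s≤s⁻¹ (≤-trans p<r r≤1+y)) =
  s≤s (atMost-below y P R below (wi-tail r R wi))
... | no r≰1+y rewrite atMost-reject (suc y) r R r≰1+y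
                    | atMost-none (suc y) R (All.map (<-≤-trans (≰⇒> r≰1+y)) (wi-head≤ r R wi)) = z≤n

rw-cons : ∀ R S → rw (R ∷ S) ≡ rw S ++ R
rw-cons R S = begin
  concat (reverse (R ∷ S))       ≡⟨ cong concat (unfold-reverse R S) ⟩
  concat (reverse S ++ R ∷ [])   ≡⟨ sym (concat-++ (reverse S) (R ∷ [])) ⟩
  concat (reverse S) ++ R ++ []  ≡⟨ cong (concat (reverse S) ++_) (++-identityʳ R) ⟩
  rw S ++ R                      ∎
  where open ≡-Reasoning

count-rw : ∀ x S → count x (rw S) ≡ count x (concat S)
count-rw x [] = refl
count-rw x (R ∷ S) = begin
  count x (rw (R ∷ S))               ≡⟨ cong (count x) (rw-cons R S) ⟩
  count x (rw S ++ R)                ≡⟨ count-++ x (rw S) R ⟩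
  count x (rw S) + count x R         ≡⟨ cong (_+ count x R) (count-rw x S) ⟩
  count x (concat S) + count x R     ≡⟨ +-comm (count x (concat S)) (count x R) ⟩
  count x R + count x (concat S)     ≡⟨ sym (count-++ x R (concat S)) ⟩
  count x (concat (R ∷ S))           ∎
  where open ≡-Reasoning

unmatched-rw-cons : ∀ j R S → WeaklyIncreasing R →
  unmatched j 0 (rw (R ∷ S)) ≡ (unmatched j 0 (rw S) ∸ count j R) + count (suc j) R
unmatched-rw-cons j R S wi = begin
  unmatched j 0 (rw (R ∷ S))                   ≡⟨ cong (unmatched j 0) (rw-cons R S) ⟩
  unmatched j 0 (rw S ++ R)                    ≡⟨ unmatched-++ j 0 (rw S) R ⟩
  unmatched j (unmatched j 0 (rw S)) R         ≡⟨ unmatched-sortedRow j (unmatched j 0 (rw S)) R wi ⟩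
  (unmatched j 0 (rw S) ∸ count j R) + count (suc j) R ∎
  where open ≡-Reasoning

Bounds : ℕ → List ℕ → List (List ℕ) → Set
Bounds j R T = (unmatched j 0 (rw T) + count j (concat T) ≤ atMost (suc j) R)
             × (count j (concat T) ≤ atMost j R)

-- the arithmetic of putting a row on top: u open brackets and x letters j below,
-- a letters j and b letters j+1 in the new row, L its entries ≤ j-1
bounds-arith : ∀ u x a b L → u + x ≤ L + a → x ≤ L → ((u ∸ a) + b) + (a + x) ≤ (L + a) + b
bounds-arith u x a b L u+x≤ x≤L with ≤-total a u
... | inj₁ a≤u = ≤-trans (≤-reflexive reassoc) (+-monoˡ-≤ b u+x≤)
  where
  shuffle : ∀ d b a x → (d + b) + (a + x) ≡ ((d + a) + x) + b
  shuffle = solve-∀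
  reassoc : ((u ∸ a) + b) + (a + x) ≡ (u + x) + b
  reassoc = trans (shuffle (u ∸ a) b a x) (cong (λ t → (t + x) + b) (m∸n+n≡m a≤u))
... | inj₂ u≤a rewrite m≤n⇒m∸n≡0 u≤a =
  ≤-trans (≤-reflexive (+-comm b (a + x)))
          (+-monoˡ-≤ b (≤-trans (+-monoʳ-≤ a x≤L) (≤-reflexive (+-comm a L))))

bounds-step : ∀ i R S → WeaklyIncreasing R →
  unmatched (suc i) 0 (rw S) + count (suc i) (concat S) ≤ atMost (suc i) R →
  count (suc i) (concat S) ≤ atMost i R →
  Bounds (suc i) R (R ∷ S)
bounds-step i R S wi openAndJ≤ j≤
  rewrite unmatched-rw-cons (suc i) R S wi | count-++ (suc i) R (concat S)
        | atMost-suc (suc i) R | atMost-suc i R =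
  bounds-arith (unmatched (suc i) 0 (rw S)) (count (suc i) (concat S))
               (count (suc i) R) (count (suc (suc i)) R) (atMost i R) openAndJ≤ j≤ ,
  ≤-trans (+-monoʳ-≤ (count (suc i) R) j≤) (≤-reflexive (+-comm (count (suc i) R) (atMost i R)))

bounds : ∀ i R S → All WeaklyIncreasing (R ∷ S) → ColumnStrict (R ∷ S) → Bounds (suc i) R (R ∷ S)
bounds i R [] (wi ∷ _) _ = bounds-step i R [] wi z≤n z≤n
bounds i R (R′ ∷ S) (wi ∷ wis@(wi′ ∷ _)) (R′-below , cs) =
  bounds-step i R (R′ ∷ S) wi
    (≤-trans openAndJ≤ (atMost-below (suc i) R R′ below wi′))
    (≤-trans j≤ (atMost-below i R R′ below wi′))
  where
  below : Below R R′
  below = strictlyBelow⇒Below R R′ R′-below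
  openAndJ≤ : unmatched (suc i) 0 (rw (R′ ∷ S)) + count (suc i) (concat (R′ ∷ S)) ≤ atMost (suc (suc i)) R′
  openAndJ≤ = proj₁ (bounds i R′ S wis cs)
  j≤ : count (suc i) (concat (R′ ∷ S)) ≤ atMost (suc i) R′
  j≤ = proj₂ (bounds i R′ S wis cs)

unmatchedRest≤ : ∀ a b n first rest → SHST a b n first rest →
  ∀ j → 1 ≤ j → unmatched j 0 (rw rest) ≤ count j first
unmatchedRest≤ a b n first [] T j _ = z≤n
unmatchedRest≤ a b n first (R ∷ S) T (suc i) _ with suc i ≤? a + b + 1
... | yes j≤max =
  +-cancelʳ-≤ (count j (concat (R ∷ S))) (unmatched j 0 (rw (R ∷ S))) (count j first) (begin
    unmatched j 0 (rw (R ∷ S)) + count j (concat (R ∷ S)) ≤⟨ proj₁ (bounds i R S wis cs) ⟩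
    atMost (suc j) R                                      ≤⟨ length-filter (_≤? suc j) R ⟩
    length R                                              ≡⟨ lenR ⟩
    n                                                     ≡⟨ sym (content j (s≤s z≤n) j≤max) ⟩
    count j (concat (first ∷ R ∷ S))                      ≡⟨ count-++ j first (concat (R ∷ S)) ⟩
    count j first + count j (concat (R ∷ S))              ∎)
  where
  open SHST T
  open ≤-Reasoning
  j = suc i
  wis : All WeaklyIncreasing (R ∷ S)
  wis = All.tail (proj₁ ssyt)
  cs : ColumnStrict (R ∷ S)
  cs = proj₂ (proj₂ ssyt)
  lenR : length R ≡ n
  lenR = All.head restLen
... | no j≰max = begin
    unmatched j 0 (rw (R ∷ S))              ≤⟨ unmatched-≤ j 0 (rw (R ∷ S)) ⟩
    count (suc j) (rw (R ∷ S))              ≡⟨ count-rw (suc j) (R ∷ S) ⟩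
    count (suc j) (concat (R ∷ S))          ≡⟨ count-none (suc j) (concat (R ∷ S)) (concat⁺ rangeRest) ⟩
    0                                       ≤⟨ z≤n ⟩
    count j first                           ∎
  where
  open SHST T
  open ≤-Reasoning
  j = suc i
  -- every entry of the lower rows is at most a+b+1 < j+1
  rangeRest : All (All (_≢ suc j)) (R ∷ S)
  rangeRest = All.map (All.map (λ { (_ , x≤max) refl → j≰max (≤-trans (n≤1+n j) x≤max) }))
                      (All.tail entryRange)

depth-firstRow : ∀ a b n first rest → SHST a b n first rest →
  ∀ j → 1 ≤ j → depth j (rw (first ∷ rest)) ≡ count (suc j) first
depth-firstRow a b n first rest T j 1≤j = begin
  depth j (rw (first ∷ rest))                                  ≡⟨ depth≡unmatched j (rw (first ∷ rest)) ⟩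
  unmatched j 0 (rw (first ∷ rest))                            ≡⟨ unmatched-rw-cons j first rest wiFirst ⟩
  (unmatched j 0 (rw rest) ∸ count j first) + count (suc j) first
    ≡⟨ cong (_+ count (suc j) first) (m≤n⇒m∸n≡0 (unmatchedRest≤ a b n first rest T j 1≤j)) ⟩
  count (suc j) first                                          ∎
  where
  open ≡-Reasoning
  wiFirst : WeaklyIncreasing first
  wiFirst = All.head (proj₁ (SHST.ssyt T))

mainTheorem5 : (a b n : ℕ) → 1 ≤ n →
    ((first : List ℕ) (rest rest′ : List (List ℕ)) →
      SHST a b n first rest → SHST a b n first rest′ →
      (j : ℕ) → 1 ≤ j → depth j (rw (first ∷ rest)) ≡ depth j (rw (first ∷ rest′)))
    × ((first : List ℕ) (rest : List (List ℕ)) → SHST a b n first rest →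
      (j : ℕ) → 1 ≤ j → j ≤ a + b →
      depth j (rw (first ∷ rest)) ≡ count (1 + j) first)
mainTheorem5 a b n _ = depthIndependent , depthFormula
  where
  depthIndependent : (first : List ℕ) (rest rest′ : List (List ℕ)) →
    SHST a b n first rest → SHST a b n first rest′ →
    (j : ℕ) → 1 ≤ j → depth j (rw (first ∷ rest)) ≡ depth j (rw (first ∷ rest′))
  depthIndependent first rest rest′ T T′ j 1≤j =
    trans (depth-firstRow a b n first rest T j 1≤j) (sym (depth-firstRow a b n first rest′ T′ j 1≤j))

  depthFormula : (first : List ℕ) (rest : List (List ℕ)) → SHST a b n first rest →
    (j : ℕ) → 1 ≤ j → j ≤ a + b → depth j (rw (first ∷ rest)) ≡ count (1 + j) first
  depthFormula first rest T j 1≤j _ = depth-firstRow a b n first rest T j 1≤j
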